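{- Let $\phi_0(\bar x,\bar y)$ and $\phi_1(\bar x,\bar y)$ be well-defined formulas whose free variables are among $\bar x,\bar y$ (where $\bar x=x_1,\dots,x_n$), and let $\psi(\bar y)\equiv Q_1x_1\ldots Q_nx_n.\ (\mathbf{U}\wedge\phi_0(\bar x,\bar y))\vee\phi_1(\bar x,\bar y)$, where $Q_1,\dots,Q_n\in\{\forall,\exists\}$. If $\psi(\bar y)$ is well-defined for all values of the variables $\bar y$, then $\psi(\bar y)$ is equivalent to $Q_1x_1\ldots Q_nx_n.\ \phi_1(\bar x,\bar y)$.
   Context: Formulas are evaluated in strong Kleene three-valued logic with truth values false $<$ undefined $<$ true, where $\mathbf{U}$ is a truth constant denoting "undefined", $\wedge,\vee$ are min and max, $\neg$ swaps true and false and fixes undefined, and $\exists x$ (resp. $\forall x$) takes the maximum (resp. minimum) of the truth values over all elements of the domain. A formula is well-defined if its value is true or false under every valuation; two formulas are equivalent if they have the same truth value (possibly undefined) under every valuation. -}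

module Defs where

open import Data.Nat using (ℕ; _≡ᵇ_)
open import Data.Bool using (if_then_else_)
open import Data.Vec using (Vec; []; _∷_)
open import Data.Product using (Σ; _×_)
open import Data.Sum using (_⊎_)
open import Data.Empty using (⊥)
open import Data.Unit using (⊤)
open import Relation.Nullary using (¬_)
open import Relation.Binary.PropositionalEquality using (_≡_)
open import Function.Bundles using (_⇔_)

-- Truth values of strong Kleene logic: false < undefined < true.
data TV : Set where
  ff uu tt : TV

record Structure : Set₁ where
  field
    Domain : Set
    Atom   : Set
    ⟦_⟧ₐ   : Atom → (ℕ → Domain) → TV

data Quant : Set where
  ∀Q ∃Q : Quant

data Formula (A : Set) : Set where
  atom     : A → Formula A
  𝐓 𝐅 𝐔    : Formula A
  ¬ᶠ_      : Formula A → Formula A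
  _∧ᶠ_ _∨ᶠ_ : Formula A → Formula A → Formula A
  Qᶠ       : Quant → ℕ → Formula A → Formula A

module Semantics (S : Structure) where
  open Structure S

  Valuation : Set
  Valuation = ℕ → Domain

  _[_↦_] : Valuation → ℕ → Domain → Valuation
  (ρ [ x ↦ d ]) z = if z ≡ᵇ x then d else ρ z

  -- "φ has value true" and "φ has value false" under ρ.
  -- (∃ = maximum: true iff some instance true, false iff all false;
  --  ∀ = minimum: true iff all true, false iff some instance false.)
  IsTrue IsFalse : Formula Atom → Valuation → Set
  IsTrue (atom a) ρ = ⟦ a ⟧ₐ ρ ≡ tt
  IsTrue 𝐓 ρ = ⊤
  IsTrue 𝐅 ρ = ⊥
  IsTrue 𝐔 ρ = ⊥
  IsTrue (¬ᶠ φ) ρ = IsFalse φ ρ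
  IsTrue (φ ∧ᶠ ψ) ρ = IsTrue φ ρ × IsTrue ψ ρ
  IsTrue (φ ∨ᶠ ψ) ρ = IsTrue φ ρ ⊎ IsTrue ψ ρ
  IsTrue (Qᶠ ∃Q x φ) ρ = Σ Domain λ d → IsTrue φ (ρ [ x ↦ d ])
  IsTrue (Qᶠ ∀Q x φ) ρ = (d : Domain) → IsTrue φ (ρ [ x ↦ d ])
  IsFalse (atom a) ρ = ⟦ a ⟧ₐ ρ ≡ ff
  IsFalse 𝐓 ρ = ⊥
  IsFalse 𝐅 ρ = ⊤
  IsFalse 𝐔 ρ = ⊥
  IsFalse (¬ᶠ φ) ρ = IsTrue φ ρ
  IsFalse (φ ∧ᶠ ψ) ρ = IsFalse φ ρ ⊎ IsFalse ψ ρ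
  IsFalse (φ ∨ᶠ ψ) ρ = IsFalse φ ρ × IsFalse ψ ρ
  IsFalse (Qᶠ ∃Q x φ) ρ = (d : Domain) → IsFalse φ (ρ [ x ↦ d ])
  IsFalse (Qᶠ ∀Q x φ) ρ = Σ Domain λ d → IsFalse φ (ρ [ x ↦ d ])

  HasValue : Formula Atom → Valuation → TV → Set
  HasValue φ ρ tt = IsTrue φ ρ
  HasValue φ ρ ff = IsFalse φ ρ
  HasValue φ ρ uu = ¬ IsTrue φ ρ × ¬ IsFalse φ ρ

  WellDefined : Formula Atom → Set
  WellDefined φ = (ρ : Valuation) → IsTrue φ ρ ⊎ IsFalse φ ρ

  Equivalent : Formula Atom → Formula Atom → Set
  Equivalent φ ψ = (ρ : Valuation) (v : TV) → HasValue φ ρ v ⇔ HasValue ψ ρ v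

prefix : {A : Set} {n : ℕ} → Vec Quant n → Vec ℕ n → Formula A → Formula A
prefix [] [] φ = φ
prefix (q ∷ qs) (x ∷ xs) φ = Qᶠ q x (prefix qs xs φ)

module Submission where

-- The disjunct 𝐔 ∧ φ₀ is never true, so the matrix (𝐔 ∧ φ₀) ∨ φ₁ is true exactly
-- where φ₁ is and false only where φ₁ is; by monotonicity of quantifiers the same
-- holds for ψ and Q̄x̄. φ₁.  Where Q̄x̄. φ₁ is false, ψ cannot be true, so by
-- well-definedness ψ is false too.

open import Defs
open import Data.Nat using (ℕ)
open import Data.Vec using (Vec; []; _∷_)
open import Data.Product using (_,_; proj₂)
open import Data.Sum using (inj₁; inj₂)
open import Data.Empty using (⊥; ⊥-elim)
open import Relation.Binary.PropositionalEquality using (sym; trans)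
open import Function.Bundles using (_⇔_; mk⇔; Equivalence)

module _ (S : Structure) where
  open Structure S
  open Semantics S

  ¬isTrue×isFalse : (φ : Formula Atom) (ρ : Valuation) → IsTrue φ ρ → IsFalse φ ρ → ⊥
  ¬isTrue×isFalse (atom a) ρ p q with trans (sym p) q
  ... | ()
  ¬isTrue×isFalse (¬ᶠ φ) ρ p q = ¬isTrue×isFalse φ ρ q p
  ¬isTrue×isFalse (φ ∧ᶠ ψ) ρ (p , _) (inj₁ q) = ¬isTrue×isFalse φ ρ p q
  ¬isTrue×isFalse (φ ∧ᶠ ψ) ρ (_ , p) (inj₂ q) = ¬isTrue×isFalse ψ ρ p q
  ¬isTrue×isFalse (φ ∨ᶠ ψ) ρ (inj₁ p) (q , _) = ¬isTrue×isFalse φ ρ p q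
  ¬isTrue×isFalse (φ ∨ᶠ ψ) ρ (inj₂ p) (_ , q) = ¬isTrue×isFalse ψ ρ p q
  ¬isTrue×isFalse (Qᶠ ∀Q x φ) ρ p (d , q) = ¬isTrue×isFalse φ _ (p d) q
  ¬isTrue×isFalse (Qᶠ ∃Q x φ) ρ (d , p) q = ¬isTrue×isFalse φ _ p (q d)

  prefix-mono-IsTrue : ∀ {n} (Qs : Vec Quant n) (xs : Vec ℕ n) {α β : Formula Atom} →
    (∀ ρ → IsTrue α ρ → IsTrue β ρ) →
    ∀ ρ → IsTrue (prefix Qs xs α) ρ → IsTrue (prefix Qs xs β) ρ
  prefix-mono-IsTrue [] [] α⇒β ρ p = α⇒β ρ p
  prefix-mono-IsTrue (∀Q ∷ Qs) (x ∷ xs) α⇒β ρ p d = prefix-mono-IsTrue Qs xs α⇒β _ (p d)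
  prefix-mono-IsTrue (∃Q ∷ Qs) (x ∷ xs) α⇒β ρ (d , p) = d , prefix-mono-IsTrue Qs xs α⇒β _ p

  prefix-mono-IsFalse : ∀ {n} (Qs : Vec Quant n) (xs : Vec ℕ n) {α β : Formula Atom} →
    (∀ ρ → IsFalse α ρ → IsFalse β ρ) →
    ∀ ρ → IsFalse (prefix Qs xs α) ρ → IsFalse (prefix Qs xs β) ρ
  prefix-mono-IsFalse [] [] α⇒β ρ p = α⇒β ρ p
  prefix-mono-IsFalse (∃Q ∷ Qs) (x ∷ xs) α⇒β ρ p d = prefix-mono-IsFalse Qs xs α⇒β _ (p d)
  prefix-mono-IsFalse (∀Q ∷ Qs) (x ∷ xs) α⇒β ρ (d , p) = d , prefix-mono-IsFalse Qs xs α⇒β _ p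

  equivalent-from-IsTrue-IsFalse : {φ ψ : Formula Atom} →
    (∀ ρ → IsTrue φ ρ ⇔ IsTrue ψ ρ) → (∀ ρ → IsFalse φ ρ ⇔ IsFalse ψ ρ) → Equivalent φ ψ
  equivalent-from-IsTrue-IsFalse T F ρ tt = T ρ
  equivalent-from-IsTrue-IsFalse T F ρ ff = F ρ
  equivalent-from-IsTrue-IsFalse T F ρ uu = mk⇔
    (λ { (¬t , ¬f) → (λ t → ¬t (Equivalence.from (T ρ) t)) , (λ f → ¬f (Equivalence.from (F ρ) f)) })
    (λ { (¬t , ¬f) → (λ t → ¬t (Equivalence.to (T ρ) t)) , (λ f → ¬f (Equivalence.to (F ρ) f)) })

  wellDefined-equivalent : {ψ χ : Formula Atom} → WellDefined ψ →
    (∀ ρ → IsTrue ψ ρ ⇔ IsTrue χ ρ) → (∀ ρ → IsFalse ψ ρ → IsFalse χ ρ) → Equivalent ψ χ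
  wellDefined-equivalent {ψ} {χ} wd T F = equivalent-from-IsTrue-IsFalse T (λ ρ → mk⇔ (F ρ) (from ρ))
    where
    from : ∀ ρ → IsFalse χ ρ → IsFalse ψ ρ
    from ρ χ-false with wd ρ
    ... | inj₁ ψ-true = ⊥-elim (¬isTrue×isFalse χ ρ (Equivalence.to (T ρ) ψ-true) χ-false)
    ... | inj₂ ψ-false = ψ-false

mainTheorem11 : (S : Structure) (n : ℕ) (Qs : Vec Quant n) (xs : Vec ℕ n)
    (φ₀ φ₁ : Formula (Structure.Atom S)) →
    Semantics.WellDefined S φ₀ → Semantics.WellDefined S φ₁ →
    Semantics.WellDefined S (prefix Qs xs ((𝐔 ∧ᶠ φ₀) ∨ᶠ φ₁)) →
    Semantics.Equivalent S (prefix Qs xs ((𝐔 ∧ᶠ φ₀) ∨ᶠ φ₁)) (prefix Qs xs φ₁)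
mainTheorem11 S n Qs xs φ₀ φ₁ _ _ ψ-wd =
  wellDefined-equivalent S ψ-wd
    (λ ρ → mk⇔ (prefix-mono-IsTrue S Qs xs matrix-true⇒φ₁-true ρ)
                (prefix-mono-IsTrue S Qs xs (λ _ → inj₂) ρ))
    (prefix-mono-IsFalse S Qs xs (λ _ → proj₂))
  where
  open Semantics S
  matrix-true⇒φ₁-true : ∀ ρ → IsTrue ((𝐔 ∧ᶠ φ₀) ∨ᶠ φ₁) ρ → IsTrue φ₁ ρ
  matrix-true⇒φ₁-true ρ (inj₁ (() , _))
  matrix-true⇒φ₁-true ρ (inj₂ φ₁-true) = φ₁-true
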